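{- Let $I=((G,\lambda),F,k)$ be an instance of Temporal Transitive Completion, where $G=(V,E)$ and $F$ is a proper orientation of $E$. Then $I$ is a no-instance if for some $u,v\in V$ one of the following holds: (1) there are time-edges $(vu,t)\in X((G,\lambda),F)$ and $(uv,t')\in X((G,\lambda),F)$; (2) there is an arc $uv\in F$ with $(vu,T_{v,u})\in X((G,\lambda),F)$; (3) there is an arc $vu\in F$ with $(vu,T_{v,u})\in X((G,\lambda),F)$ and $\lambda(v,u)<T_{v,u}$.
   Context: A temporal graph is $(G,\lambda)$ with $G=(V,E)$ finite simple undirected and $\lambda:E\to\mathbb{N}$; a proper orientation $F$ contains exactly one of $uv$, $vu$ for each $\{u,v\}\in E$, and arc $uv$ carries label $\lambda(u,v)$. A proper orientation is temporally transitive if whenever $(uv,t_1),(vw,t_2)$ are oriented time-edges with $t_2\ge t_1$ there is an oriented time-edge $(uw,t_3)$ with $t_3\ge t_2$. Temporal Transitive Completion: given $(G,\lambda)$, orientation $F$, integer $k$, is there a temporal supergraph $(G'',\lambda'')$ ($G''=(V,E'')$, $E\subseteq E''$, $\lambda''|_E=\lambda$) with $|E''\setminus E|\le k$ and a temporally transitive orientation $F''\supseteq F$ of it? Let $G'=(V,F)$. A directed path $P$ in $G'$ is tail-heavy if the label of its last arc is largest among all its arcs; $t(P)$ is that last label. $T_{u,v}$ is the maximum of $t(P)$ over tail-heavy directed $(u,v)$-paths of length at least $2$ in $G'$ ($\bot$ if none), and $X((G,\lambda),F)=\{(uv,T_{u,v}):T_{u,v}\neq\bot\}$. -}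

module Defs where

open import Data.Nat using (ℕ; _≤_; _<_; _<ᵇ_; _+_)
open import Data.Bool using (Bool; true; false; _∧_; not; _xor_; if_then_else_)
open import Data.Fin using (Fin; toℕ)
open import Data.List using (List; []; _∷_; _++_; map; concatMap; allFin)
open import Data.Nat.ListAction using (sum)
open import Data.List.Relation.Unary.All using (All)
open import Data.List.Relation.Unary.Linked using (Linked)
open import Data.List.Relation.Unary.Unique.Propositional using (Unique)
open import Data.Product using (Σ; _×_; _,_)
open import Data.Sum using (_⊎_)
open import Relation.Binary.PropositionalEquality using (_≡_)

-- The (finite, simple, undirected)
-- edge set is a symmetric irreflexive Boolean adjacency relation; the labelling
-- λ : E → ℕ is a symmetric function on ordered pairs (values on non-edges are
-- irrelevant junk).
record TemporalGraph (n : ℕ) : Set where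
  field
    E       : Fin n → Fin n → Bool
    E-sym   : ∀ u v → E u v ≡ E v u
    E-irr   : ∀ u → E u u ≡ false
    lab     : Fin n → Fin n → ℕ
    lab-sym : ∀ u v → lab u v ≡ lab v u
open TemporalGraph public

Orientation : ℕ → Set
Orientation n = Fin n → Fin n → Bool

ProperOrientation : ∀ {n} → TemporalGraph n → Orientation n → Set
ProperOrientation G F =
  (∀ u v → F u v ≡ true → E G u v ≡ true) ×
  (∀ u v → E G u v ≡ true → (F u v xor F v u) ≡ true)

TemporallyTransitive : ∀ {n} → (Fin n → Fin n → ℕ) → Orientation n → Set
TemporallyTransitive {n} lab F =
  ∀ (u v w : Fin n) → F u v ≡ true → F v w ≡ true → lab u v ≤ lab v w →
  F u w ≡ true × lab v w ≤ lab u w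

allPairs : ∀ n → List (Fin n × Fin n)
allPairs n = concatMap (λ i → map (λ j → (i , j)) (allFin n)) (allFin n)

newEdgeCount : ∀ {n} → TemporalGraph n → TemporalGraph n → ℕ
newEdgeCount {n} G G'' =
  sum (map (λ { (i , j) → if (toℕ i <ᵇ toℕ j) ∧ E G'' i j ∧ not (E G i j)
                          then 1 else 0 }) (allPairs n))

TTCSolution : ∀ {n} → TemporalGraph n → Orientation n → ℕ → Set
TTCSolution {n} G F k =
  Σ (TemporalGraph n) λ G'' →
    (∀ u v → E G u v ≡ true → E G'' u v ≡ true) ×
    (∀ u v → E G u v ≡ true → lab G'' u v ≡ lab G u v) ×
    newEdgeCount G G'' ≤ k ×
    Σ (Orientation n) λ F'' →
      ProperOrientation G'' F'' ×
      (∀ u v → F u v ≡ true → F'' u v ≡ true) ×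
      TemporallyTransitive (lab G'') F''

arcLabels : ∀ {n} → (Fin n → Fin n → ℕ) → List (Fin n) → List ℕ
arcLabels lab (x ∷ y ∷ rest) = lab x y ∷ arcLabels lab (y ∷ rest)
arcLabels lab _ = []

-- The path's vertex sequence is u ∷ ys ++ w ∷ v ∷ [] (distinct vertices,
-- consecutive pairs are arcs of F); its last arc is wv, with label t, which is
-- the largest label along the path.
TailHeavyPath : ∀ {n} → TemporalGraph n → Orientation n →
                Fin n → Fin n → ℕ → Set
TailHeavyPath {n} G F u v t =
  Σ (List (Fin n)) λ ys → Σ (Fin n) λ w →
    Unique (u ∷ ys ++ w ∷ v ∷ []) ×
    Linked (λ x y → F x y ≡ true) (u ∷ ys ++ w ∷ v ∷ []) ×
    t ≡ lab G w v ×
    All (λ s → s ≤ t) (arcLabels (lab G) (u ∷ ys ++ w ∷ v ∷ []))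

-- T_{u,v} = t (≠ ⊥): t is the maximum of t(P) over tail-heavy (u,v)-paths of
-- length ≥ 2.  Equivalently (uv, t) ∈ X((G,λ),F).
T≡ : ∀ {n} → TemporalGraph n → Orientation n → Fin n → Fin n → ℕ → Set
T≡ G F u v t =
  TailHeavyPath G F u v t × (∀ t' → TailHeavyPath G F u v t' → t' ≤ t)

InX : ∀ {n} → TemporalGraph n → Orientation n → Fin n → Fin n → ℕ → Set
InX = T≡

module Submission where

open import Defs
open import Data.Nat using (ℕ; _<_; _≤_)
open import Data.Nat.Properties using (≤-trans; <⇒≱)
open import Data.Bool using (Bool; true; _xor_)
open import Data.Fin using (Fin)
open import Data.List using ([]; _∷_; _++_)
open import Data.List.Relation.Unary.All using (All; _∷_)
open import Data.List.Relation.Unary.Linked as Linked using (Linked; []; [-]; _∷_)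
open import Data.Product using (Σ; _×_; _,_; proj₁; proj₂)
open import Data.Sum using (_⊎_; [_,_]′)
open import Relation.Binary.PropositionalEquality
  using (_≡_; refl; sym; cong₂; subst; subst₂)
open import Relation.Nullary using (¬_)

-- In a temporally transitive orientation a tail-heavy path u → … → w → v can be
-- shortcut from its end: for an arc x y of the path, λ(x,y) ≤ λ(w,v) ≤ the label
-- of the shortcut y v already obtained, so transitivity yields the arc x v with
-- label ≥ λ(w,v).  A solution keeps the arcs and labels of F, hence every
-- tail-heavy (u,v)-path with t(P) = t forces the arc uv with label ≥ t.  Each of
-- the three conditions then forces both uv and vu, or λ(v,u) ≥ T_{v,u} > λ(v,u).

xor-both-true : ∀ {a b : Bool} → a ≡ true → b ≡ true → ¬ (a xor b) ≡ true
xor-both-true refl refl ()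

proper⇒asymmetric : ∀ {n} {G : TemporalGraph n} {F : Orientation n} →
  ProperOrientation G F → ∀ {u v} → F u v ≡ true → ¬ F v u ≡ true
proper⇒asymmetric (arc⇒edge , edge⇒xor) {u} {v} uv vu =
  xor-both-true uv vu (edge⇒xor u v (arc⇒edge u v uv))

module _ {a r} {A : Set a} {R : A → A → Set r} where

  Linked-++⁻ʳ : ∀ xs {ys} → Linked R (xs ++ ys) → Linked R ys
  Linked-++⁻ʳ []       linked = linked
  Linked-++⁻ʳ (x ∷ xs) linked = Linked-++⁻ʳ xs (Linked.tail linked)

module _ {n} {R : Fin n → Fin n → Set} {lab lab′ : Fin n → Fin n → ℕ}
         (agree : ∀ {x y} → R x y → lab x y ≡ lab′ x y) where

  arcLabels-cong : ∀ {xs} → Linked R xs → arcLabels lab xs ≡ arcLabels lab′ xs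
  arcLabels-cong []          = refl
  arcLabels-cong [-]         = refl
  arcLabels-cong (xy ∷ rest) = cong₂ _∷_ (agree xy) (arcLabels-cong rest)

module _ {n} {lab : Fin n → Fin n → ℕ} {F : Orientation n}
         (transitive : TemporallyTransitive lab F) where

  tailHeavy-shortcut : ∀ x ys w v →
    Linked (λ a b → F a b ≡ true) (x ∷ ys ++ w ∷ v ∷ []) →
    All (_≤ lab w v) (arcLabels lab (x ∷ ys ++ w ∷ v ∷ [])) →
    F x v ≡ true × lab w v ≤ lab x v
  tailHeavy-shortcut x [] w v (xw ∷ wv ∷ [-]) (xw≤wv ∷ _) =
    transitive x w v xw wv xw≤wv
  tailHeavy-shortcut x (y ∷ ys) w v (xy ∷ rest) (xy≤wv ∷ rest≤wv) =
    let yv , wv≤yv = tailHeavy-shortcut y ys w v rest rest≤wv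
        xv , yv≤xv = transitive x y v xy yv (≤-trans xy≤wv wv≤yv)
    in xv , ≤-trans wv≤yv yv≤xv

tailHeavyPath-forces-arc : ∀ {n} {G G″ : TemporalGraph n} {F F″ : Orientation n} →
  (∀ u v → F u v ≡ true → E G u v ≡ true) →
  (∀ u v → E G u v ≡ true → lab G″ u v ≡ lab G u v) →
  (∀ u v → F u v ≡ true → F″ u v ≡ true) →
  TemporallyTransitive (lab G″) F″ →
  ∀ {u v t} → TailHeavyPath G F u v t → F″ u v ≡ true × t ≤ lab G″ u v
tailHeavyPath-forces-arc {G = G} {G″} {F} {F″} arc⇒edge kept F⊆F″ transitive
  {u} {v} (ys , w , _ , linked , refl , bounded) =
  let uv , wv≤uv = tailHeavy-shortcut transitive u ys w v linked″ bounded″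
  in uv , subst (_≤ lab G″ u v) (labels-kept wv) wv≤uv
  where
  labels-kept : ∀ {x y} → F x y ≡ true → lab G″ x y ≡ lab G x y
  labels-kept {x} {y} xy = kept x y (arc⇒edge x y xy)

  wv : F w v ≡ true
  wv = Linked.head (Linked-++⁻ʳ (u ∷ ys) linked)

  linked″ : Linked (λ a b → F″ a b ≡ true) (u ∷ ys ++ w ∷ v ∷ [])
  linked″ = Linked.map (F⊆F″ _ _) linked

  bounded″ : All (_≤ lab G″ w v) (arcLabels (lab G″) (u ∷ ys ++ w ∷ v ∷ []))
  bounded″ = subst₂ (λ L → All (_≤ L)) (sym (labels-kept wv))
    (arcLabels-cong (λ xy → sym (labels-kept xy)) linked) bounded

corollary4p5 : ∀ {n : ℕ} (G : TemporalGraph n) (F : Orientation n) (k : ℕ) →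
    ProperOrientation G F → (u v : Fin n) →
    ((Σ ℕ λ t → Σ ℕ λ t' → InX G F v u t × InX G F u v t')
    ⊎ (F u v ≡ true × Σ ℕ λ t → InX G F v u t)
    ⊎ (F v u ≡ true × Σ ℕ λ t → InX G F v u t × lab G v u < t)) →
    ¬ TTCSolution G F k
corollary4p5 G F _ proper u v condition
  (G″ , _ , kept , _ , F″ , proper″ , F⊆F″ , transitive) =
  [ (λ (_ , _ , (vu-path , _) , (uv-path , _)) →
        asymmetric″ (arc uv-path) (arc vu-path))
  , [ (λ (uv , _ , (vu-path , _)) →
          asymmetric″ (F⊆F″ u v uv) (arc vu-path))
    , (λ (vu , t , (vu-path , _) , λvu<t) →
          <⇒≱ λvu<t (subst (t ≤_) (kept v u (proj₁ proper v u vu)) (label vu-path)))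
    ]′
  ]′ condition
  where
  asymmetric″ : F″ u v ≡ true → ¬ F″ v u ≡ true
  asymmetric″ = proper⇒asymmetric {G = G″} proper″

  forced : ∀ {x y t} → TailHeavyPath G F x y t → F″ x y ≡ true × t ≤ lab G″ x y
  forced = tailHeavyPath-forces-arc {G = G} {G″} (proj₁ proper) kept F⊆F″ transitive

  arc : ∀ {x y t} → TailHeavyPath G F x y t → F″ x y ≡ true
  arc path = proj₁ (forced path)

  label : ∀ {x y t} → TailHeavyPath G F x y t → t ≤ lab G″ x y
  label path = proj₂ (forced path)
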